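{- Let $D$ be an $n\times n$ matrix of integer ranges $D_{uv}=[\ell_{uv},r_{uv}]$ and let $k$ be the number of undetermined entries of $D$. If there exists a temporal graph $\mathcal{G}$ on $[n]$ with $\mathrm{Fo}(\mathcal{G})_{uv}\in D_{uv}$ for all $u,v\in[n]$, then there exists a temporal graph $\mathcal{G}'$ on $[n]$ with $\mathrm{Fo}(\mathcal{G}')_{uv}\in D_{uv}$ for all $u,v\in[n]$ all of whose time labels lie in the set $\{\ell_{uw}+j \mid u\neq w,\ 0\le j\le k\}$.
   Context: A temporal graph $\mathcal{G}=(G,\lambda)$ consists of a static undirected graph $G=(V,E)$ with $V=[n]$ and $\lambda:E\to 2^{\mathbb{N}_{>0}}$ assigning to each edge the set of positive times (time labels) at which it appears. A strict temporal $uv$-path is a path $u=v_0,\dots,v_k=v$ in $G$ with distinct vertices and times $\tau_1<\dots<\tau_k$, $\tau_i\in\lambda(\{v_{i-1},v_i\})$; its arrival time is $\tau_k$. $\mathrm{Fo}(\mathcal{G})$ is the $n\times n$ matrix with diagonal $0$ and entry $(u,v)$, $u\neq v$, the minimum arrival time of a strict temporal $uv$-path ($\infty$ if none). Here $D_{uv}=[\ell_{uv},r_{uv}]=\{\ell_{uv},\dots,r_{uv}\}$, and an entry $(u,v)$ is undetermined if $\ell_{uv}\neq r_{uv}$. -}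

module Defs where

open import Data.Nat using (ℕ; zero; suc; _+_; _≤_; _<_)
open import Data.Nat.Properties using () renaming (_≟_ to _≟ℕ_)
open import Data.Fin using (Fin)
open import Data.Bool using (Bool; true; false)
open import Data.List using (List; []; _∷_; map; allFin)
open import Data.Nat.ListAction using (sum)
open import Data.List.Relation.Unary.Unique.Propositional using (Unique)
open import Data.Product using (Σ; _×_; ∃)
open import Data.Sum using (_⊎_)
open import Relation.Nullary using (¬_; yes; no)
open import Relation.Binary.PropositionalEquality using (_≡_; _≢_)

data ℕ∞ : Set where
  fin : ℕ → ℕ∞
  ∞   : ℕ∞

data _≤∞_ : ℕ∞ → ℕ∞ → Set where
  fin≤fin : ∀ {a b} → a ≤ b → fin a ≤∞ fin b
  x≤∞     : ∀ {x} → x ≤∞ ∞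

-- A temporal graph on vertex set [n] = Fin n: label u v t = true iff
-- the edge {u,v} is present at time t.  Labels are symmetric, there are
-- no loops and all times are positive.
record TemporalGraph (n : ℕ) : Set where
  field
    label  : Fin n → Fin n → ℕ → Bool
    sym    : ∀ u v t → label u v t ≡ label v u t
    noLoop : ∀ u t → label u u t ≡ false
    pos    : ∀ u v → label u v 0 ≡ false
open TemporalGraph public

-- Temporal walk from u to v, last time t (0 for the trivial walk),
-- visiting the vertex list vs (reversed), with strictly increasing times.
data TWalk {n : ℕ} (G : TemporalGraph n) (u : Fin n) :
       Fin n → ℕ → List (Fin n) → Set where
  start : TWalk G u u 0 (u ∷ [])
  step  : ∀ {v w t t' vs} → TWalk G u v t vs → label G v w t' ≡ true →
          t < t' → TWalk G u w t' (w ∷ vs)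

HasPath : ∀ {n} → TemporalGraph n → Fin n → Fin n → ℕ → Set
HasPath G u v t = Σ (List _) λ vs → TWalk G u v t vs × Unique vs

FoIs : ∀ {n} → TemporalGraph n → Fin n → Fin n → ℕ∞ → Set
FoIs G u v x =
  (u ≡ v × x ≡ fin 0) ⊎
  (u ≢ v ×
    ((Σ ℕ λ t → x ≡ fin t × HasPath G u v t × (∀ t' → HasPath G u v t' → t ≤ t'))
     ⊎ (x ≡ ∞ × (∀ t → ¬ HasPath G u v t))))

record Range : Set where
  constructor [_,_]
  field
    lo : ℕ∞
    hi : ℕ∞
open Range public

_∈R_ : ℕ∞ → Range → Set
x ∈R D = lo D ≤∞ x × x ≤∞ hi D

RangeMatrix : ℕ → Set
RangeMatrix n = Fin n → Fin n → Range

Realizes : ∀ {n} → TemporalGraph n → RangeMatrix n → Set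
Realizes G D = ∀ u v → Σ ℕ∞ λ x → FoIs G u v x × x ∈R D u v

undet : Range → ℕ
undet [ fin a , fin b ] with a ≟ℕ b
... | yes _ = 0
... | no  _ = 1
undet [ fin _ , ∞ ] = 1
undet [ ∞ , fin _ ] = 1
undet [ ∞ , ∞ ] = 0

numUndet : ∀ {n} → RangeMatrix n → ℕ
numUndet {n} D = sum (map (λ u → sum (map (λ v → undet (D u v)) (allFin n))) (allFin n))

InLabelSet : ∀ {n} → RangeMatrix n → ℕ → ℕ → Set
InLabelSet {n} D k t =
  Σ (Fin n) λ u → Σ (Fin n) λ w → u ≢ w ×
  Σ ℕ λ l → lo (D u w) ≡ fin l × Σ ℕ λ j → j ≤ k × t ≡ l + j

-- Sort the finite off-diagonal entries t₁ < t₂ < … of Fo(G) and compress time: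
-- c(tᵢ) = max(c(tᵢ₋₁) + 1, largest ℓ_{xy} with Fo(G)_{xy} = tᵢ), c(0) = 0.
-- Keeping only the edges at foremost times tᵢ, moved to c(tᵢ), turns every foremost
-- path into one arriving at c(Fo(G)_{uv}) and creates no faster path, since c is
-- monotone and strictly increasing into the tᵢ; as ℓ_{uv} ≤ c(Fo(G)_{uv}) ≤ Fo(G)_{uv}
-- the new graph still realizes D.  Each new time c(tᵢ) is either some ℓ_{xy}, or
-- exceeds c(tᵢ₋₁) by one while an entry ℓ_{xy} ≤ c(tᵢ₋₁) < tᵢ = Fo(G)_{xy} ≤ r_{xy}
-- becomes settled; such an entry is undetermined, so every new time is ℓ_{xy} + j with
-- j at most the number k of undetermined entries.
module Submission where

open import Defs
open import Data.Nat using (ℕ)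
open import Data.Bool using (true)
open import Data.Product using (Σ; _×_)
open import Relation.Binary.PropositionalEquality using (_≡_)

open import Data.Nat using (zero; suc; _≤_; _<_; _≤′_; ≤′-refl; ≤′-step; z≤n; s≤s)
open import Data.Nat.Properties
open import Data.Nat.Induction using (<-rec)
open import Data.Nat.ListAction using (sum)
open import Data.Fin using (Fin)
import Data.Fin.Properties as Fin
import Data.Bool.Properties as Bool
open import Data.List using (List; []; _∷_; map; filter; allFin; cartesianProduct)
open import Data.List.Extrema.Nat using (max; ⊥≤max; xs≤max; max≤v⁺; argmax-sel)
open import Data.List.Relation.Unary.Any using (here; there)
open import Data.List.Relation.Unary.All as All using (All; []; _∷_)
open import Data.List.Relation.Unary.All.Properties.Core using (¬Any⇒All¬)
open import Data.List.Relation.Unary.AllPairs using ([]; _∷_)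
open import Data.List.Relation.Unary.Unique.Propositional using (Unique)
open import Data.List.Membership.Propositional using (_∈_)
open import Data.List.Membership.Propositional.Properties
  using (∈-allFin; ∈-map∘filter⁺; ∈-map∘filter⁻; ∈-cartesianProduct⁺)
open import Data.Product using (_,_; proj₁; proj₂; ∃; ∃₂; uncurry)
open import Data.Sum using (_⊎_; inj₁; inj₂)
open import Function using (id; _∘_)
open import Function.Bundles using (mk⇔)
open import Relation.Nullary using (¬_; Dec; yes; no; does; proof; contradiction; ¬?; map′)
open import Relation.Nullary.Decidable using (_×-dec_; dec-true; dec-false; does-⇔)
open import Relation.Nullary.Reflects using (Reflects; invert)
open import Relation.Binary.Definitions using (DecidableEquality)
open import Relation.Binary.PropositionalEquality using (_≢_; refl; trans; cong; subst)
import Relation.Binary.PropositionalEquality as ≡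

⌊_⌋∞ : ℕ∞ → ℕ
⌊ fin a ⌋∞ = a
⌊ ∞ ⌋∞     = 0

map∞ : (ℕ → ℕ) → ℕ∞ → ℕ∞
map∞ φ (fin a) = fin (φ a)
map∞ φ ∞       = ∞

_≟∞_ : DecidableEquality ℕ∞
fin a ≟∞ fin b = map′ (cong fin) (λ { refl → refl }) (a ≟ b)
fin _ ≟∞ ∞     = no λ ()
∞     ≟∞ fin _ = no λ ()
∞     ≟∞ ∞     = yes refl

≤∞-trans : ∀ {X Y Z} → X ≤∞ Y → Y ≤∞ Z → X ≤∞ Z
≤∞-trans (fin≤fin p) (fin≤fin q) = fin≤fin (≤-trans p q)
≤∞-trans _           x≤∞         = x≤∞

≤fin-inv : ∀ {L t} → L ≤∞ fin t → L ≡ fin ⌊ L ⌋∞ × ⌊ L ⌋∞ ≤ t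
≤fin-inv (fin≤fin p) = refl , p

0<undet : ∀ r {t l} → fin t ∈R r → lo r ≡ fin l → l < t → 0 < undet r
0<undet [ fin a , fin b ] (_ , fin≤fin t≤b) refl a<t with a ≟ b
... | yes refl = contradiction (<-≤-trans a<t t≤b) (<-irrefl refl)
... | no _     = s≤s z≤n
0<undet [ fin _ , ∞ ] _ _ _ = s≤s z≤n
0<undet [ ∞ , _ ] _ () _

sum-map-mono-≤ : ∀ {A : Set} {f g : A → ℕ} xs → (∀ a → f a ≤ g a) →
                 sum (map f xs) ≤ sum (map g xs)
sum-map-mono-≤ []       f≤g = z≤n
sum-map-mono-≤ (x ∷ xs) f≤g = +-mono-≤ (f≤g x) (sum-map-mono-≤ xs f≤g)

sum-map-mono-< : ∀ {A : Set} {f g : A → ℕ} {a xs} → (∀ a → f a ≤ g a) →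
                 a ∈ xs → f a < g a → sum (map f xs) < sum (map g xs)
sum-map-mono-< {xs = _ ∷ xs} f≤g (here refl) fa<ga =
  +-mono-<-≤ fa<ga (sum-map-mono-≤ xs f≤g)
sum-map-mono-< {xs = x ∷ _}  f≤g (there a∈) fa<ga =
  +-mono-≤-< (f≤g x) (sum-map-mono-< f≤g a∈ fa<ga)

ΣΣ : ∀ {n} → (Fin n → Fin n → ℕ) → ℕ
ΣΣ {n} h = sum (map (λ u → sum (map (λ v → h u v) (allFin n))) (allFin n))

ΣΣ-mono-≤ : ∀ {n} {g h : Fin n → Fin n → ℕ} → (∀ u v → g u v ≤ h u v) → ΣΣ g ≤ ΣΣ h
ΣΣ-mono-≤ {n} g≤h = sum-map-mono-≤ (allFin n) (λ u → sum-map-mono-≤ (allFin n) (g≤h u))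

ΣΣ-mono-< : ∀ {n} {g h : Fin n → Fin n → ℕ} → (∀ u v → g u v ≤ h u v) →
            ∀ x y → g x y < h x y → ΣΣ g < ΣΣ h
ΣΣ-mono-< {n} g≤h x y gxy<hxy =
  sum-map-mono-< (λ u → sum-map-mono-≤ (allFin n) (g≤h u)) (∈-allFin x)
    (sum-map-mono-< (g≤h x) (∈-allFin y) gxy<hxy)

ifAtMost : ℕ → ℕ∞ → ℕ → ℕ
ifAtMost t (fin s) k with s ≤? t
... | yes _ = k
... | no _  = 0
ifAtMost t ∞ k = 0

ifAtMost-≤ : ∀ t X k → ifAtMost t X k ≤ k
ifAtMost-≤ t (fin s) k with s ≤? t
... | yes _ = ≤-refl
... | no _  = z≤n
ifAtMost-≤ t ∞ k = z≤n

ifAtMost-mono : ∀ t X k → ifAtMost t X k ≤ ifAtMost (suc t) X k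
ifAtMost-mono t (fin s) k with s ≤? t | s ≤? suc t
... | yes _   | yes _    = ≤-refl
... | yes s≤t | no s≰1+t = contradiction (m≤n⇒m≤1+n s≤t) s≰1+t
... | no _    | _        = z≤n
ifAtMost-mono t ∞ k = z≤n

ifAtMost-jump : ∀ t {k} → 0 < k → ifAtMost t (fin (suc t)) k < ifAtMost (suc t) (fin (suc t)) k
ifAtMost-jump t 0<k with suc t ≤? t | suc t ≤? suc t
... | yes 1+t≤t | _          = contradiction 1+t≤t (<-irrefl refl)
... | no _      | yes _      = 0<k
... | no _      | no 1+t≰1+t = contradiction ≤-refl 1+t≰1+t

module _ {n} (D : RangeMatrix n) where

  InLabelSet-lower : ∀ {x y l k} → x ≢ y → lo (D x y) ≡ fin l → InLabelSet D k l
  InLabelSet-lower {x} {y} {l} x≢y eq = x , y , x≢y , l , eq , 0 , z≤n , ≡.sym (+-identityʳ l)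

  InLabelSet-suc : ∀ {k s} → InLabelSet D k s → InLabelSet D (suc k) (suc s)
  InLabelSet-suc (x , y , x≢y , l , eq , j , j≤k , s≡l+j) =
    x , y , x≢y , l , eq , suc j , s≤s j≤k , trans (cong suc s≡l+j) (≡.sym (+-suc l j))

  InLabelSet-mono : ∀ {k k′ s} → k ≤ k′ → InLabelSet D k s → InLabelSet D k′ s
  InLabelSet-mono k≤k′ (x , y , x≢y , l , eq , j , j≤k , s≡l+j) =
    x , y , x≢y , l , eq , j , ≤-trans j≤k k≤k′ , s≡l+j

advance : ℕ → List ℕ → ℕ
advance a []         = a
advance a ls@(_ ∷ _) = max (suc a) ls

a≤advance : ∀ a ls → a ≤ advance a ls
a≤advance a []       = ≤-refl
a≤advance a (l ∷ ls) = ≤-trans (n≤1+n a) (⊥≤max (suc a) (l ∷ ls))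

advance-∈ : ∀ {a l ls} → l ∈ ls → advance a ls ≡ max (suc a) ls
advance-∈ (here _)  = refl
advance-∈ (there _) = refl

a<advance : ∀ {a l ls} → l ∈ ls → a < advance a ls
a<advance {a} {ls = ls} l∈ls = subst (a <_) (≡.sym (advance-∈ l∈ls)) (⊥≤max (suc a) ls)

∈⇒≤advance : ∀ {a l ls} → l ∈ ls → l ≤ advance a ls
∈⇒≤advance {a} {l} {ls} l∈ls =
  subst (l ≤_) (≡.sym (advance-∈ l∈ls)) (All.lookup (xs≤max (suc a) ls) l∈ls)

advance≤ : ∀ {a b ls} → a < b → All (_≤ b) ls → advance a ls ≤ b
advance≤ {ls = []}    a<b _     = <⇒≤ a<b
advance≤ {ls = _ ∷ _} a<b ls≤b = max≤v⁺ a<b ls≤b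

advance-sel : ∀ a ls → advance a ls ≡ a ⊎ advance a ls ∈ ls
                     ⊎ (advance a ls ≡ suc a × ∃ λ l → l ∈ ls × l ≤ a)
advance-sel a [] = inj₁ refl
advance-sel a (l ∷ ls) with argmax-sel id (suc a) (l ∷ ls)
... | inj₂ m∈ = inj₂ (inj₁ m∈)
... | inj₁ m≡1+a with m≤n⇒m<n∨m≡n (subst (l ≤_) m≡1+a (All.head (xs≤max (suc a) (l ∷ ls))))
...   | inj₁ l<1+a = inj₂ (inj₂ (m≡1+a , l , here refl , ≤-pred l<1+a))
...   | inj₂ l≡1+a = inj₂ (inj₁ (here (trans m≡1+a (≡.sym l≡1+a))))

module _ {n} {G : TemporalGraph n} where

  label-pos : ∀ {u v s} → label G u v s ≡ true → 0 < s
  label-pos {u} {v} {zero} e = contradiction (trans (≡.sym e) (pos G u v)) λ ()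
  label-pos {s = suc _}      _ = s≤s z≤n

  HasPath-refl : ∀ {u} → HasPath G u u 0
  HasPath-refl = _ , start , [] ∷ []

  HasPath-pos : ∀ {u v t} → u ≢ v → HasPath G u v t → 0 < t
  HasPath-pos u≢v (_ , start , _)       = contradiction refl u≢v
  HasPath-pos u≢v (_ , step _ _ lt , _) = ≤-<-trans z≤n lt

  TWalk-prefix : ∀ {u w s vs v} → TWalk G u w s vs → Unique vs → v ∈ vs →
                 ∃ λ s′ → s′ ≤ s × HasPath G u v s′
  TWalk-prefix start          un       (here refl) = 0 , z≤n , HasPath-refl
  TWalk-prefix (step wk e lt) un       (here refl) = _ , ≤-refl , (_ , step wk e lt , un)
  TWalk-prefix (step wk e lt) (_ ∷ un) (there v∈)  with TWalk-prefix wk un v∈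
  ... | s′ , s′≤ , p = s′ , ≤-trans s′≤ (<⇒≤ lt) , p

  HasPath-last-edge : ∀ {u v t} → u ≢ v → HasPath G u v t →
                      ∃₂ λ w t₀ → HasPath G u w t₀ × t₀ < t × label G w v t ≡ true
  HasPath-last-edge u≢v (_ , start , _)             = contradiction refl u≢v
  HasPath-last-edge u≢v (_ , step wk e lt , _ ∷ un) = _ , _ , (_ , wk , un) , lt , e

  HasPath-extend : ∀ {u w v s s′} → HasPath G u w s → label G w v s′ ≡ true → s < s′ →
                   (∀ {s″} → HasPath G u v s″ → s < s″) → HasPath G u v s′
  HasPath-extend (vs , wk , un) e s<s′ late =
    _ , step wk e s<s′ , ¬Any⇒All¬ vs v∉vs ∷ un
    where
    v∉vs : ¬ _ ∈ vs
    v∉vs v∈ with TWalk-prefix wk un v∈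
    ... | _ , s″≤s , p = <⇒≱ (late p) s″≤s

  fo-diag : ∀ {x X} → FoIs G x x X → X ≡ fin 0
  fo-diag (inj₁ (_ , eq))  = eq
  fo-diag (inj₂ (x≢x , _)) = contradiction refl x≢x

  fo-path : ∀ {x y X t} → x ≢ y → FoIs G x y X → X ≡ fin t → HasPath G x y t
  fo-path x≢y (inj₁ (x≡y , _))                     _    = contradiction x≡y x≢y
  fo-path _   (inj₂ (_ , inj₁ (_ , refl , p , _))) refl = p
  fo-path _   (inj₂ (_ , inj₂ (refl , _)))         ()

  fo-min : ∀ {x y X t t′} → FoIs G x y X → X ≡ fin t → HasPath G x y t′ → t ≤ t′
  fo-min (inj₁ (_ , refl))                      refl _ = z≤n
  fo-min (inj₂ (_ , inj₁ (_ , refl , _ , min))) refl p = min _ p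
  fo-min (inj₂ (_ , inj₂ (refl , _)))           ()

  fo-≤-path : ∀ {x y X t} → FoIs G x y X → HasPath G x y t → ∃ λ t₀ → X ≡ fin t₀ × t₀ ≤ t
  fo-≤-path (inj₁ (_ , refl))                       _ = 0 , refl , z≤n
  fo-≤-path (inj₂ (_ , inj₁ (t₀ , refl , _ , min))) p = t₀ , refl , min _ p
  fo-≤-path (inj₂ (_ , inj₂ (_ , none)))            p = contradiction p (none _)

OffDiagEntry : ∀ {n} → (Fin n → Fin n → ℕ∞) → ℕ → Set
OffDiagEntry F t = ∃₂ λ x y → x ≢ y × F x y ≡ fin t

module Relabel {n} (G : TemporalGraph n) (F : Fin n → Fin n → ℕ∞)
  (F-fo : ∀ x y → FoIs G x y (F x y))
  (φ : ℕ → ℕ) (φ-mono : ∀ {t t′} → t ≤ t′ → φ t ≤ φ t′) (φ-zero : φ 0 ≡ 0)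
  (φ-strict : ∀ {t t′} → OffDiagEntry F t′ → t < t′ → φ t < φ t′) where

  RelabelledEdge : Fin n → Fin n → ℕ → Set
  RelabelledEdge w v s = ∃ λ t → OffDiagEntry F t × φ t ≡ s × label G w v t ≡ true

  relabelledEdge? : ∀ w v s → Dec (RelabelledEdge w v s)
  relabelledEdge? w v s =
    map′ (λ (x , y , x≢y , t , eq , rest) → t , (x , y , x≢y , eq) , rest)
         (λ (t , (x , y , x≢y , eq) , rest) → x , y , x≢y , t , eq , rest)
         (Fin.any? λ x → Fin.any? λ y → ¬? (x Fin.≟ y) ×-dec edgeAtEntry? (F x y))
    where
    edgeAtEntry? : ∀ X → Dec (∃ λ t → X ≡ fin t × φ t ≡ s × label G w v t ≡ true)
    edgeAtEntry? ∞       = no λ { (_ , () , _) }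
    edgeAtEntry? (fin t) = map′ (λ p → t , refl , p) (λ { (_ , refl , p) → p })
                                (φ t ≟ s ×-dec label G w v t Bool.≟ true)

  entry-pos : ∀ {t} → OffDiagEntry F t → 0 < t
  entry-pos (x , y , x≢y , eq) = HasPath-pos x≢y (fo-path x≢y (F-fo x y) eq)

  φ-pos : ∀ {t} → OffDiagEntry F t → 0 < φ t
  φ-pos {t} q = subst (_< φ t) φ-zero (φ-strict q (entry-pos q))

  φ-cancel-< : ∀ {t t′} → φ t < φ t′ → t < t′
  φ-cancel-< φt<φt′ = ≰⇒> λ t′≤t → <⇒≱ φt<φt′ (φ-mono t′≤t)

  relabel : TemporalGraph n
  relabel = record
    { label  = λ w v s → does (relabelledEdge? w v s)
    ; sym    = λ w v s → does-⇔ (mk⇔ flip flip) (relabelledEdge? w v s) (relabelledEdge? v w s)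
    ; noLoop = λ u s → dec-false (relabelledEdge? u u s)
                 λ (t , _ , _ , e) → contradiction (trans (≡.sym e) (noLoop G u t)) λ ()
    ; pos    = λ u v → dec-false (relabelledEdge? u v 0)
                 λ (_ , q , φt≡0 , _) → <⇒≢ (φ-pos q) (≡.sym φt≡0)
    }
    where
    flip : ∀ {w v s} → RelabelledEdge w v s → RelabelledEdge v w s
    flip {w} {v} (t , q , eq , e) = t , q , eq , trans (sym G v w t) e

  relabel-edge⁻ : ∀ {w v s} → label relabel w v s ≡ true → RelabelledEdge w v s
  relabel-edge⁻ {w} {v} {s} e = invert (subst (Reflects _) e (proof (relabelledEdge? w v s)))

  relabel-edge⁺ : ∀ {w v t} → OffDiagEntry F t → label G w v t ≡ true →
                  label relabel w v (φ t) ≡ true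
  relabel-edge⁺ q e = dec-true (relabelledEdge? _ _ _) (_ , q , refl , e)

  TWalk-back : ∀ {u v s vs} → TWalk relabel u v s vs → ∃ λ t → φ t ≡ s × TWalk G u v t vs
  TWalk-back start = 0 , φ-zero , start
  TWalk-back (step wk e lt) with TWalk-back wk | relabel-edge⁻ e
  ... | _ , refl , wk′ | t′ , _ , refl , e′ = t′ , refl , step wk′ e′ (φ-cancel-< lt)

  HasPath-back : ∀ {u v s} → HasPath relabel u v s → ∃ λ t → φ t ≡ s × HasPath G u v t
  HasPath-back (vs , wk , un) with TWalk-back wk
  ... | t , φt≡s , wk′ = t , φt≡s , (vs , wk′ , un)

  φ-fo-≤ : ∀ {u v t s} → F u v ≡ fin t → HasPath relabel u v s → φ t ≤ s
  φ-fo-≤ eq p with HasPath-back p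
  ... | _ , refl , p′ = φ-mono (fo-min (F-fo _ _) eq p′)

  -- Induction on t: a foremost path to w ends with an edge from some v with Fo_{uv} < t;
  -- appending that edge to the relabelled path to v repeats no vertex, because no
  -- relabelled path reaches w before φ t.
  HasPath-forward : ∀ u t w → F u w ≡ fin t → HasPath relabel u w (φ t)
  HasPath-forward u = <-rec (λ t → ∀ w → F u w ≡ fin t → HasPath relabel u w (φ t)) go
    where
    go : ∀ t → (∀ {t′} → t′ < t → ∀ w → F u w ≡ fin t′ → HasPath relabel u w (φ t′)) →
         ∀ w → F u w ≡ fin t → HasPath relabel u w (φ t)
    go t ih w eq with u Fin.≟ w
    ... | yes refl with trans (≡.sym eq) (fo-diag (F-fo u u))
    ...   | refl = subst (HasPath relabel u u) (≡.sym φ-zero) HasPath-refl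
    go t ih w eq | no u≢w with HasPath-last-edge u≢w (fo-path u≢w (F-fo u w) eq)
    ... | v , t₀ , p , t₀<t , e with fo-≤-path (F-fo u v) p
    ...   | tᵥ , eqᵥ , tᵥ≤t₀ =
      HasPath-extend (ih tᵥ<t v eqᵥ) (relabel-edge⁺ q e) (φ-strict q tᵥ<t)
        λ p′ → <-≤-trans (φ-strict q tᵥ<t) (φ-fo-≤ eq p′)
      where
      q : OffDiagEntry F t
      q = u , w , u≢w , eq
      tᵥ<t : tᵥ < t
      tᵥ<t = ≤-<-trans tᵥ≤t₀ t₀<t

  relabel-fo : ∀ x y → FoIs relabel x y (map∞ φ (F x y))
  relabel-fo x y with F-fo x y
  ... | inj₁ (refl , eq) rewrite eq = inj₁ (refl , cong fin φ-zero)
  ... | inj₂ (x≢y , inj₁ (t , eq , _)) rewrite eq =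
    inj₂ (x≢y , inj₁ (φ t , refl , HasPath-forward x t y eq , λ _ → φ-fo-≤ eq))
  ... | inj₂ (x≢y , inj₂ (eq , none)) rewrite eq =
    inj₂ (x≢y , inj₂ (refl , λ _ p → none _ (proj₂ (proj₂ (HasPath-back p)))))

module Compression {n} (D : RangeMatrix n) (F : Fin n → Fin n → ℕ∞)
  (F∈D : ∀ x y → F x y ∈R D x y) (F-diag : ∀ x → F x x ≡ fin 0) where

  -- Junk value 0 when ℓ_{xy} = ∞; it is only used at entries, where ℓ_{xy} is finite.
  lower : Fin n → Fin n → ℕ
  lower x y = ⌊ lo (D x y) ⌋∞

  entry-∈R : ∀ {x y t} → F x y ≡ fin t → fin t ∈R D x y
  entry-∈R {x} {y} eq = subst (_∈R D x y) eq (F∈D x y)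

  lo≡lower : ∀ {x y t} → F x y ≡ fin t → lo (D x y) ≡ fin (lower x y)
  lo≡lower = proj₁ ∘ ≤fin-inv ∘ proj₁ ∘ entry-∈R

  lower≤ : ∀ {x y t} → F x y ≡ fin t → lower x y ≤ t
  lower≤ = proj₂ ∘ ≤fin-inv ∘ proj₁ ∘ entry-∈R

  entryAt? : ∀ t ((x , y) : Fin n × Fin n) → Dec (x ≢ y × F x y ≡ fin t)
  entryAt? t (x , y) = ¬? (x Fin.≟ y) ×-dec (F x y ≟∞ fin t)

  pairs : List (Fin n × Fin n)
  pairs = cartesianProduct (allFin n) (allFin n)

  lowersAt : ℕ → List ℕ
  lowersAt t = map (uncurry lower) (filter (entryAt? t) pairs)

  ∈-lowersAt⁺ : ∀ {x y t} → x ≢ y → F x y ≡ fin t → lower x y ∈ lowersAt t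
  ∈-lowersAt⁺ {x} {y} {t} x≢y eq = ∈-map∘filter⁺ (uncurry lower) (entryAt? t)
    ((x , y) , ∈-cartesianProduct⁺ (∈-allFin x) (∈-allFin y) , refl , x≢y , eq)

  ∈-lowersAt⁻ : ∀ {l t} → l ∈ lowersAt t → ∃₂ λ x y → (x ≢ y × F x y ≡ fin t) × l ≡ lower x y
  ∈-lowersAt⁻ {t = t} l∈ with ∈-map∘filter⁻ (uncurry lower) (entryAt? t) {xs = pairs} l∈
  ... | (x , y) , _ , l≡ , entry = x , y , entry , l≡

  compress : ℕ → ℕ
  compress zero    = 0
  compress (suc t) = advance (compress t) (lowersAt (suc t))

  compress-mono-≤′ : ∀ {t t′} → t ≤′ t′ → compress t ≤ compress t′
  compress-mono-≤′ ≤′-refl        = ≤-refl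
  compress-mono-≤′ {t′ = suc t′} (≤′-step t≤′t′) =
    ≤-trans (compress-mono-≤′ t≤′t′) (a≤advance (compress t′) (lowersAt (suc t′)))

  compress-mono-≤ : ∀ {t t′} → t ≤ t′ → compress t ≤ compress t′
  compress-mono-≤ = compress-mono-≤′ ∘ ≤⇒≤′

  compress-strict : ∀ {t t′} → OffDiagEntry F t′ → t < t′ → compress t < compress t′
  compress-strict (x , y , x≢y , eq) (s≤s t≤t′) =
    ≤-<-trans (compress-mono-≤ t≤t′) (a<advance (∈-lowersAt⁺ x≢y eq))

  compress-≤ : ∀ t → compress t ≤ t
  compress-≤ zero    = z≤n
  compress-≤ (suc t) = advance≤ (s≤s (compress-≤ t)) (All.tabulate lowersAt-≤)
    where
    lowersAt-≤ : ∀ {l} → l ∈ lowersAt (suc t) → l ≤ suc t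
    lowersAt-≤ l∈ with ∈-lowersAt⁻ l∈
    ... | _ , _ , (_ , eq) , refl = lower≤ eq

  lower≤compress : ∀ {x y t} → x ≢ y → F x y ≡ fin t → lower x y ≤ compress t
  lower≤compress {t = zero}  _   eq = lower≤ eq
  lower≤compress {t = suc _} x≢y eq = ∈⇒≤advance (∈-lowersAt⁺ x≢y eq)

  compress-∈R : ∀ x y → map∞ compress (F x y) ∈R D x y
  compress-∈R x y with x Fin.≟ y
  ... | yes refl rewrite F-diag x = subst (_∈R D x x) (F-diag x) (F∈D x x)
  ... | no x≢y with F x y in eq
  ...   | ∞     = subst (_∈R D x y) eq (F∈D x y)
  ...   | fin t =
    subst (_≤∞ fin (compress t)) (≡.sym (lo≡lower eq)) (fin≤fin (lower≤compress x≢y eq)) ,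
    ≤∞-trans (fin≤fin (compress-≤ t)) (proj₂ (entry-∈R eq))

  undetUpTo : ℕ → ℕ
  undetUpTo t = ΣΣ λ x y → ifAtMost t (F x y) (undet (D x y))

  undetUpTo-≤ : ∀ t → undetUpTo t ≤ numUndet D
  undetUpTo-≤ t = ΣΣ-mono-≤ λ x y → ifAtMost-≤ t (F x y) (undet (D x y))

  undetUpTo-mono : ∀ t → undetUpTo t ≤ undetUpTo (suc t)
  undetUpTo-mono t = ΣΣ-mono-≤ λ x y → ifAtMost-mono t (F x y) (undet (D x y))

  -- An entry with ℓ_{xy} ≤ t < Fo_{xy} ≤ r_{xy} is undetermined.
  undetUpTo-jump : ∀ {x y t} → F x y ≡ fin (suc t) → lower x y ≤ t →
                   undetUpTo t < undetUpTo (suc t)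
  undetUpTo-jump {x} {y} {t} eq l≤t =
    ΣΣ-mono-< (λ u v → ifAtMost-mono t (F u v) (undet (D u v))) x y
      (subst (λ X → ifAtMost t X _ < ifAtMost (suc t) X _) (≡.sym eq)
        (ifAtMost-jump t (0<undet (D x y) (entry-∈R eq) (lo≡lower eq) (s≤s l≤t))))

  compress-labelled : ∀ t → 0 < compress t → InLabelSet D (undetUpTo t) (compress t)
  compress-labelled (suc t) 0<c with advance-sel (compress t) (lowersAt (suc t))
  ... | inj₁ c≡ = subst (InLabelSet D _) (≡.sym c≡)
    (InLabelSet-mono D (undetUpTo-mono t) (compress-labelled t (subst (0 <_) c≡ 0<c)))
  ... | inj₂ (inj₁ c∈) with ∈-lowersAt⁻ c∈
  ...   | _ , _ , (x≢y , eq) , c≡ =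
    subst (InLabelSet D _) (≡.sym c≡) (InLabelSet-lower D x≢y (lo≡lower eq))
  compress-labelled (suc t) 0<c | inj₂ (inj₂ (c≡ , _ , l∈ , l≤cₜ)) with ∈-lowersAt⁻ l∈
  ... | _ , _ , (x≢y , eq) , refl = subst (InLabelSet D _) (≡.sym c≡)
    (InLabelSet-mono D (undetUpTo-jump eq (≤-trans l≤cₜ (compress-≤ t))) (InLabelSet-suc D previous))
    where
    previous : InLabelSet D (undetUpTo t) (compress t)
    previous with compress t ≟ 0
    ... | no cₜ≢0  = compress-labelled t (n≢0⇒n>0 cₜ≢0)
    ... | yes cₜ≡0 = subst (InLabelSet D _) (≡.sym cₜ≡0) (InLabelSet-lower D x≢y
      (trans (lo≡lower eq) (cong fin (n≤0⇒n≡0 (subst (_ ≤_) cₜ≡0 l≤cₜ)))))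

  compress-InLabelSet : ∀ {t} → 0 < compress t → InLabelSet D (numUndet D) (compress t)
  compress-InLabelSet {t} 0<c = InLabelSet-mono D (undetUpTo-≤ t) (compress-labelled t 0<c)

lemma3p21 : (n : ℕ) (D : RangeMatrix n) →
    Σ (TemporalGraph n) (λ G → Realizes G D) →
    Σ (TemporalGraph n) (λ G' → Realizes G' D ×
    (∀ u v t → label G' u v t ≡ true → InLabelSet D (numUndet D) t))
lemma3p21 n D (G , G-realizes) = relabel , relabel-realizes , relabel-labels
  where
  F : Fin n → Fin n → ℕ∞
  F x y = proj₁ (G-realizes x y)

  F-fo : ∀ x y → FoIs G x y (F x y)
  F-fo x y = proj₁ (proj₂ (G-realizes x y))

  open Compression D F (λ x y → proj₂ (proj₂ (G-realizes x y))) (λ x → fo-diag (F-fo x x))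
  open Relabel G F F-fo compress compress-mono-≤ refl compress-strict

  relabel-realizes : Realizes relabel D
  relabel-realizes x y = map∞ compress (F x y) , relabel-fo x y , compress-∈R x y

  relabel-labels : ∀ u v s → label relabel u v s ≡ true → InLabelSet D (numUndet D) s
  relabel-labels u v s e with relabel-edge⁻ e
  ... | t , _ , refl , _ = compress-InLabelSet {t} (label-pos {G = relabel} e)
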